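{- Let $q\in\{2,3\}$ and let $\mathcal{M}_1$ and $\mathcal{M}_2$ be hereditary classes of $GF(q)$-matroids. Then $\mathcal{M}_1\cup\mathcal{M}_2$ is hereditary. Moreover, if $c$ denotes the maximum rank of a forbidden flat for $\mathcal{M}_1$ and $d$ denotes the maximum rank of a forbidden flat for $\mathcal{M}_2$, then every forbidden flat for $\mathcal{M}_1\cup\mathcal{M}_2$ has rank at most $c+d$.
   Context: All matroids are simple. A $GF(q)$-matroid is a matroid representable over the field with $q$ elements. A class of $GF(q)$-matroids is hereditary if it is closed under taking flats (restrictions to flats). A forbidden flat for a hereditary class $\mathcal{M}$ is a $GF(q)$-matroid not in $\mathcal{M}$ every proper flat of which is in $\mathcal{M}$. -}

module Defs where

open import Level using (0ℓ)
open import Data.Nat using (ℕ; zero; suc; _≤_; _<_; NonZero)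
open import Data.Nat.DivMod using (_mod_)
open import Data.Fin using (Fin; toℕ)
import Data.Nat as ℕ
open import Data.Vec using (Vec; replicate; zipWith; map)
open import Data.List using (List; []; _∷_; length)
import Data.List as L
open import Data.List.Membership.Propositional using (_∈_; _∉_)
open import Data.List.Relation.Unary.All using (All)
open import Data.List.Relation.Unary.Unique.Propositional using (Unique)
open import Data.Product using (Σ; _×_; _,_)
open import Data.Sum using (_⊎_)
open import Relation.Nullary using (¬_)
open import Relation.Binary.PropositionalEquality using (_≡_; _≢_)
open import Function.Bundles using (_⇔_)

-- Abstract matroids whose ground set is a finite duplicate-free list of
-- natural-number labels.  'Indep' is only consulted on duplicate-free
-- sublists of the ground set.

record Matroid : Set₁ where
  field
    E     : List ℕ
    Indep : List ℕ → Set
open Matroid public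

_⊆ₗ_ : List ℕ → List ℕ → Set
X ⊆ₗ Y = All (_∈ Y) X

IndepSet : Matroid → List ℕ → Set
IndepSet M X = X ⊆ₗ E M × Unique X × Indep M X

RankLE : Matroid → ℕ → Set
RankLE M k = ∀ X → IndepSet M X → length X ≤ k

-- F is a flat (closed set) of M: F ⊆ E, and adding any element of E − F
-- strictly increases the rank, i.e. r(F ∪ {e}) > r(F).
Flat : Matroid → List ℕ → Set
Flat M F =
  F ⊆ₗ E M × Unique F ×
  (∀ e → e ∈ E M → e ∉ F →
    Σ (List ℕ) λ I → IndepSet M I × I ⊆ₗ (e ∷ F) ×
      (∀ J → IndepSet M J → J ⊆ₗ F → length J < length I))

Proper : Matroid → List ℕ → Set
Proper M F = Σ ℕ λ e → e ∈ E M × e ∉ F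

_∣_ : Matroid → List ℕ → Matroid
M ∣ F = record { E = F ; Indep = Indep M }

Simple : Matroid → Set
Simple M = (∀ e → e ∈ E M → Indep M (e ∷ []))
         × (∀ e f → e ∈ E M → f ∈ E M → e ≢ f → Indep M (e ∷ f ∷ []))

-- GF(q) for prime q, as ℤ/qℤ, and linear independence over it.

module _ (q : ℕ) .{{_ : NonZero q}} where

  GF : Set
  GF = Fin q

  0F : GF
  0F = 0 mod q

  _+F_ : GF → GF → GF
  a +F b = (toℕ a ℕ.+ toℕ b) mod q

  _*F_ : GF → GF → GF
  a *F b = (toℕ a ℕ.* toℕ b) mod q

  zeroV : ∀ r → Vec GF r
  zeroV r = replicate r 0F

  lincomb : ∀ {r} → (ℕ → GF) → (ℕ → Vec GF r) → List ℕ → Vec GF r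
  lincomb {r} c φ [] = zeroV r
  lincomb c φ (x ∷ X) = zipWith _+F_ (map (c x *F_) (φ x)) (lincomb c φ X)

  LinIndep : ∀ {r} → (ℕ → Vec GF r) → List ℕ → Set
  LinIndep {r} φ X = ∀ (c : ℕ → GF) → lincomb c φ X ≡ zeroV r → All (λ x → c x ≡ 0F) X

  Representable : Matroid → Set
  Representable M = Σ ℕ λ r → Σ (ℕ → Vec GF r) λ φ →
    ∀ X → X ⊆ₗ E M → Unique X → (Indep M X ⇔ LinIndep φ X)

  GFMatroid : Matroid → Set
  GFMatroid M = Unique (E M) × Simple M × Representable M

  Class : Set₁
  Class = Matroid → Set

  ClassOfGF : Class → Set₁
  ClassOfGF 𝓜 = ∀ M → 𝓜 M → GFMatroid M

  Hereditary : Class → Set₁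
  Hereditary 𝓜 = ∀ M F → 𝓜 M → Flat M F → 𝓜 (M ∣ F)

  ForbiddenFlat : Class → Matroid → Set
  ForbiddenFlat 𝓜 N = GFMatroid N × ¬ 𝓜 N ×
    (∀ F → Flat N F → Proper N F → 𝓜 (N ∣ F))

_∪ᶜ_ : (Matroid → Set) → (Matroid → Set) → (Matroid → Set)
(𝓜₁ ∪ᶜ 𝓜₂) M = 𝓜₁ M ⊎ 𝓜₂ M

{-# OPTIONS --safe #-}
module Submission where

-- Let N be a forbidden flat of 𝓜₁ ∪ 𝓜₂. Since N lies in neither class, a minimal flat F₁ of N with
-- N|F₁ ∉ 𝓜₁ is a forbidden flat of 𝓜₁, so r(F₁) ≤ c; likewise some flat F₂ has N|F₂ ∉ 𝓜₂ and r(F₂) ≤ d.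
-- If the closure G of F₁ ∪ F₂ were a proper flat of N, then N|G would lie in 𝓜₁ or 𝓜₂, and by heredity
-- so would its flat N|F₁ or N|F₂. Hence F₁ ∪ F₂ spans N and r(N) ≤ r(F₁) + r(F₂) ≤ c + d.
--
-- The matroid facts behind this (flats of flats are flats, closures are flats, the exchange property)
-- are derived from a representation over ℤ/qℤ, which is a field because 2 and 3 are prime. Minimal flats
-- exist only classically, so they are obtained in the double-negation monad; that suffices because the
-- conclusion, an inequality between natural numbers, is decidable.

open import Defs
open import Level using (0ℓ)
open import Data.Nat as ℕ using (ℕ; NonZero; zero; suc; _∸_; _^_; _≤_; _<_; z≤n; s≤s; _≟_; _≤?_)
import Data.Nat.Properties as ℕ
open import Data.Nat.DivMod using (_%_; _mod_; %-distribˡ-+; %-distribˡ-*; [m+kn]%n≡m%n; m<n⇒m%n≡m; m%n<n; n%n≡0)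
open import Data.Nat.Induction using (<-wellFounded)
open import Data.Nat.Primality using (Prime; prime[2]; prime?; prime⇒nonTrivial)
open import Data.Nat.Coprimality using (prime⇒coprime; coprime-Bézout)
open import Data.Nat.GCD using (module Bézout)
open import Data.Fin as Fin using (Fin; toℕ; combine; remQuot; quotient; remainder)
import Data.Fin.Properties as Finₚ
open import Data.Vec using (Vec; []; _∷_; replicate; zipWith; map; fromList)
import Data.Vec.Properties as Vecₚ
open import Data.Vec.Relation.Unary.All as V using ([]; _∷_)
open import Data.List using (List; []; _∷_; [_]; length; _++_; filter; cartesianProductWith; concatMap; upTo)
open import Data.List.Properties using (length-++)
open import Data.List.Relation.Unary.All using (All; []; _∷_; tabulate; all?; sequenceM)
  renaming (lookup to All-lookup; map to All-map)
open import Data.List.Relation.Unary.All.Properties using (¬Any⇒All¬; ¬All⇒Any¬; ++⁺)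
open import Data.List.Relation.Unary.Any using (here; there)
open import Data.List.Relation.Unary.AllPairs using ([]; _∷_)
open import Data.List.Relation.Unary.Unique.Propositional using (Unique)
open import Data.List.Relation.Unary.Unique.Propositional.Properties using (filter⁺)
open import Data.List.Membership.Propositional using (_∈_; _∉_; find; lose)
open import Data.List.Membership.DecPropositional _≟_ using (_∈?_)
open import Data.List.Membership.Propositional.Properties
  using (∈-∃++; ∈-++⁻; ∈-++⁺ˡ; ∈-++⁺ʳ; ∈-filter⁺; ∈-filter⁻; ∈-cartesianProductWith⁺; ∈-concatMap⁺; ∈-upTo⁺)
open import Data.Product using (_×_; _,_; ∃; proj₁; proj₂)
open import Data.Sum using (_⊎_; inj₁; inj₂; [_,_]′)
open import Data.Empty using (⊥-elim)
open import Function using (_∘_; case_of_; Injective; _⇔_; Equivalence)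
open import Induction.WellFounded using (Acc; acc)
open import Algebra.Core using (Op₁; Op₂)
open import Algebra.Bundles using (AbelianGroup; Ring; CommutativeRing)
open import Algebra.Structures using (IsCommutativeRing)
open import Algebra.Definitions using (Associative; Commutative; LeftIdentity; LeftInverse; _DistributesOverˡ_)
open import Algebra.Consequences.Propositional
  using (comm∧idˡ⇒id; comm∧invˡ⇒inv; comm∧distrˡ⇒distrʳ; comm∧assoc⇒middleFour)
import Algebra.Properties.Ring as RingProperties
import Algebra.Properties.AbelianGroup as AbelianGroupProperties
open import Effect.Monad using (RawMonad)
open import Relation.Nullary using (¬_; Dec; yes; no)
open import Relation.Nullary.Decidable using (map′; ¬¬-excluded-middle; decidable-stable; from-yes)
open import Relation.Nullary.Negation using (¬¬-Monad)
open import Relation.Binary.PropositionalEquality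
  using (_≡_; _≢_; refl; sym; trans; cong; cong₂; subst; isEquivalence; module ≡-Reasoning)

module ℤ/qℤ (q : ℕ) .{{_ : NonZero q}} where
  open ≡-Reasoning

  infixl 6 _+_
  infixl 7 _*_
  infix 8 -_

  _+_ _*_ : GF q → GF q → GF q
  _+_ = _+F_ q
  _*_ = _*F_ q

  0# 1# : GF q
  0# = 0F q
  1# = 1 mod q

  -_ : GF q → GF q
  - a = (q ∸ toℕ a) mod q

  toℕ-mod : ∀ n → toℕ (n mod q) ≡ n % q
  toℕ-mod n = Finₚ.toℕ-fromℕ< (m%n<n n q)

  mod-cong : ∀ {m n} → m % q ≡ n % q → m mod q ≡ n mod q
  mod-cong m%q≡n%q = Finₚ.fromℕ<-cong _ _ m%q≡n%q _ _

  mod-toℕ : ∀ a → toℕ a mod q ≡ a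
  mod-toℕ a = trans (Finₚ.fromℕ<-cong _ _ (m<n⇒m%n≡m (Finₚ.toℕ<n a)) _ (Finₚ.toℕ<n a)) (Finₚ.fromℕ<-toℕ a _)

  mod-elim : {P : GF q → Set} → (∀ n → P (n mod q)) → ∀ a → P a
  mod-elim {P} P-mod a = subst P (mod-toℕ a) (P-mod (toℕ a))

  mod-self : q mod q ≡ 0#
  mod-self = mod-cong (trans (n%n≡0 q) (sym (m<n⇒m%n≡m (ℕ.>-nonZero⁻¹ q))))

  +-homo : ∀ m n → (m mod q) + (n mod q) ≡ (m ℕ.+ n) mod q
  +-homo m n = mod-cong (begin
    (toℕ (m mod q) ℕ.+ toℕ (n mod q)) % q ≡⟨ cong₂ (λ x y → (x ℕ.+ y) % q) (toℕ-mod m) (toℕ-mod n) ⟩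
    (m % q ℕ.+ n % q) % q                 ≡⟨ %-distribˡ-+ m n q ⟨
    (m ℕ.+ n) % q                         ∎)

  *-homo : ∀ m n → (m mod q) * (n mod q) ≡ (m ℕ.* n) mod q
  *-homo m n = mod-cong (begin
    (toℕ (m mod q) ℕ.* toℕ (n mod q)) % q ≡⟨ cong₂ (λ x y → (x ℕ.* y) % q) (toℕ-mod m) (toℕ-mod n) ⟩
    (m % q ℕ.* (n % q)) % q               ≡⟨ %-distribˡ-* m n q ⟨
    (m ℕ.* n) % q                         ∎)

  +-assoc : Associative _≡_ _+_
  +-assoc = mod-elim λ x → mod-elim λ y → mod-elim λ z → begin
    (x mod q) + (y mod q) + (z mod q)   ≡⟨ cong (_+ (z mod q)) (+-homo x y) ⟩
    ((x ℕ.+ y) mod q) + (z mod q)       ≡⟨ +-homo (x ℕ.+ y) z ⟩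
    (x ℕ.+ y ℕ.+ z) mod q               ≡⟨ cong (_mod q) (ℕ.+-assoc x y z) ⟩
    (x ℕ.+ (y ℕ.+ z)) mod q             ≡⟨ +-homo x (y ℕ.+ z) ⟨
    (x mod q) + ((y ℕ.+ z) mod q)       ≡⟨ cong ((x mod q) +_) (+-homo y z) ⟨
    (x mod q) + ((y mod q) + (z mod q)) ∎

  +-comm : Commutative _≡_ _+_
  +-comm = mod-elim λ x → mod-elim λ y →
    trans (+-homo x y) (trans (cong (_mod q) (ℕ.+-comm x y)) (sym (+-homo y x)))

  +-identityˡ : LeftIdentity _≡_ 0# _+_
  +-identityˡ = mod-elim λ x → +-homo 0 x

  -‿inverseˡ : LeftInverse _≡_ 0# -_ _+_
  -‿inverseˡ a = begin
    - a + a                             ≡⟨ cong (- a +_) (mod-toℕ a) ⟨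
    ((q ∸ toℕ a) mod q) + (toℕ a mod q) ≡⟨ +-homo (q ∸ toℕ a) (toℕ a) ⟩
    (q ∸ toℕ a ℕ.+ toℕ a) mod q         ≡⟨ cong (_mod q) (ℕ.m∸n+n≡m (Finₚ.toℕ≤n a)) ⟩
    q mod q                             ≡⟨ mod-self ⟩
    0#                                  ∎

  *-assoc : Associative _≡_ _*_
  *-assoc = mod-elim λ x → mod-elim λ y → mod-elim λ z → begin
    (x mod q) * (y mod q) * (z mod q)   ≡⟨ cong (_* (z mod q)) (*-homo x y) ⟩
    ((x ℕ.* y) mod q) * (z mod q)       ≡⟨ *-homo (x ℕ.* y) z ⟩
    (x ℕ.* y ℕ.* z) mod q               ≡⟨ cong (_mod q) (ℕ.*-assoc x y z) ⟩
    (x ℕ.* (y ℕ.* z)) mod q             ≡⟨ *-homo x (y ℕ.* z) ⟨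
    (x mod q) * ((y ℕ.* z) mod q)       ≡⟨ cong ((x mod q) *_) (*-homo y z) ⟨
    (x mod q) * ((y mod q) * (z mod q)) ∎

  *-comm : Commutative _≡_ _*_
  *-comm = mod-elim λ x → mod-elim λ y →
    trans (*-homo x y) (trans (cong (_mod q) (ℕ.*-comm x y)) (sym (*-homo y x)))

  *-identityˡ : LeftIdentity _≡_ 1# _*_
  *-identityˡ = mod-elim λ x → trans (*-homo 1 x) (cong (_mod q) (ℕ.*-identityˡ x))

  *-distribˡ-+ : _DistributesOverˡ_ _≡_ _*_ _+_
  *-distribˡ-+ = mod-elim λ x → mod-elim λ y → mod-elim λ z → begin
    (x mod q) * ((y mod q) + (z mod q))           ≡⟨ cong ((x mod q) *_) (+-homo y z) ⟩
    (x mod q) * ((y ℕ.+ z) mod q)                 ≡⟨ *-homo x (y ℕ.+ z) ⟩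
    (x ℕ.* (y ℕ.+ z)) mod q                       ≡⟨ cong (_mod q) (ℕ.*-distribˡ-+ x y z) ⟩
    (x ℕ.* y ℕ.+ x ℕ.* z) mod q                   ≡⟨ +-homo (x ℕ.* y) (x ℕ.* z) ⟨
    ((x ℕ.* y) mod q) + ((x ℕ.* z) mod q)         ≡⟨ cong₂ _+_ (*-homo x y) (*-homo x z) ⟨
    (x mod q) * (y mod q) + (x mod q) * (z mod q) ∎

  isCommutativeRing : IsCommutativeRing _≡_ _+_ _*_ -_ 0# 1#
  isCommutativeRing = record
    { isRing = record
      { +-isAbelianGroup = record
        { isGroup = record
          { isMonoid = record
            { isSemigroup = record
              { isMagma = record { isEquivalence = isEquivalence ; ∙-cong = cong₂ _+_ }
              ; assoc = +-assoc }
            ; identity = comm∧idˡ⇒id +-comm +-identityˡ }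
          ; inverse = comm∧invˡ⇒inv +-comm -‿inverseˡ
          ; ⁻¹-cong = cong -_ }
        ; comm = +-comm }
      ; *-cong = cong₂ _*_
      ; *-assoc = *-assoc
      ; *-identity = comm∧idˡ⇒id *-comm *-identityˡ
      ; distrib = *-distribˡ-+ , comm∧distrˡ⇒distrʳ *-comm *-distribˡ-+ }
    ; *-comm = *-comm }

  commutativeRing : CommutativeRing 0ℓ 0ℓ
  commutativeRing = record { isCommutativeRing = isCommutativeRing }

  open RingProperties (CommutativeRing.ring commutativeRing)
    using (-‿distribʳ-*; +-inverseʳ-unique; -‿involutive)

  *-inverseʳ : Prime q → ∀ a → a ≢ 0# → ∃ λ b → a * b ≡ 1#
  *-inverseʳ q-prime a a≢0 = from-Bézout (coprime-Bézout (prime⇒coprime q-prime (Finₚ.toℕ<n a)))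
    where
    n : ℕ
    n = toℕ a
    instance
      n≢0 : NonZero n
      n≢0 = ℕ.≢-nonZero λ n≡0 → a≢0 (trans (sym (mod-toℕ a)) (cong (_mod q) n≡0))
    plus-multiple : ∀ m x → (m ℕ.+ x ℕ.* q) mod q ≡ m mod q
    plus-multiple m x = mod-cong ([m+kn]%n≡m%n m x q)
    from-Bézout : Bézout.Identity 1 q n → ∃ λ b → a * b ≡ 1#
    from-Bézout (Bézout.-+ x y 1+xq≡yn) = y mod q , (begin
      a * (y mod q)           ≡⟨ cong (_* (y mod q)) (mod-toℕ a) ⟨
      (n mod q) * (y mod q)   ≡⟨ *-homo n y ⟩
      (n ℕ.* y) mod q         ≡⟨ cong (_mod q) (trans (ℕ.*-comm n y) (sym 1+xq≡yn)) ⟩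
      (1 ℕ.+ x ℕ.* q) mod q   ≡⟨ plus-multiple 1 x ⟩
      1#                      ∎)
    from-Bézout (Bézout.+- x y 1+yn≡xq) = - (y mod q) , (begin
      a * - (y mod q)         ≡⟨ -‿distribʳ-* a (y mod q) ⟨
      - (a * (y mod q))       ≡⟨ cong -_ (*-comm a (y mod q)) ⟩
      - ((y mod q) * a)       ≡⟨ cong -_ (+-inverseʳ-unique 1# _ 1+ya≡0) ⟩
      - - 1#                  ≡⟨ -‿involutive 1# ⟩
      1#                      ∎)
      where
      1+ya≡0 : 1# + (y mod q) * a ≡ 0#
      1+ya≡0 = begin
        1# + (y mod q) * a          ≡⟨ cong (λ b → 1# + (y mod q) * b) (mod-toℕ a) ⟨
        1# + (y mod q) * (n mod q)  ≡⟨ trans (cong (1# +_) (*-homo y n)) (+-homo 1 (y ℕ.* n)) ⟩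
        (1 ℕ.+ y ℕ.* n) mod q       ≡⟨ cong (_mod q) 1+yn≡xq ⟩
        (0 ℕ.+ x ℕ.* q) mod q       ≡⟨ plus-multiple 0 x ⟩
        0#                          ∎

-- Linear algebra over a finite field

vecToFin : ∀ {q} n → Vec (Fin q) n → Fin (q ^ n)
vecToFin zero [] = Fin.zero
vecToFin (suc n) (a ∷ v) = combine a (vecToFin n v)

finToVec : ∀ {q} n → Fin (q ^ n) → Vec (Fin q) n
finToVec zero _ = []
finToVec {q} (suc n) i = let (a , j) = remQuot {q} (q ^ n) i in a ∷ finToVec n j

finToVec-vecToFin : ∀ {q} n (v : Vec (Fin q) n) → finToVec n (vecToFin n v) ≡ v
finToVec-vecToFin zero [] = refl
finToVec-vecToFin {q} (suc n) (a ∷ v) =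
  trans (cong (λ (b , j) → b ∷ finToVec n j) (Finₚ.remQuot-combine {q} {q ^ n} a (vecToFin n v)))
        (cong (a ∷_) (finToVec-vecToFin n v))

vecToFin-finToVec : ∀ {q} n (i : Fin (q ^ n)) → vecToFin n (finToVec {q} n i) ≡ i
vecToFin-finToVec zero Fin.zero = refl
vecToFin-finToVec {q} (suc n) i =
  trans (cong (combine (quotient {q} (q ^ n) i)) (vecToFin-finToVec n (remainder {q} (q ^ n) i)))
        (Finₚ.combine-remQuot {q} (q ^ n) i)

injective⇒length-≤ : ∀ {q m n} → 1 < q → (f : Vec (Fin q) n → Vec (Fin q) m) →
                     Injective _≡_ _≡_ f → n ≤ m
injective⇒length-≤ {q} {m} {n} 1<q f f-injective =
  ℕ.≮⇒≥ λ m<n → ℕ.≤⇒≯ (Finₚ.injective⇒≤ g-injective) (ℕ.^-monoʳ-< q 1<q m<n)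
  where
  open ≡-Reasoning
  g : Fin (q ^ n) → Fin (q ^ m)
  g = vecToFin m ∘ f ∘ finToVec n
  g-injective : Injective _≡_ _≡_ g
  g-injective {i} {j} gi≡gj = begin
    i                       ≡⟨ vecToFin-finToVec n i ⟨
    vecToFin n (finToVec n i) ≡⟨ cong (vecToFin n) (f-injective (begin
      f (finToVec n i)        ≡⟨ finToVec-vecToFin m _ ⟨
      finToVec m (g i)        ≡⟨ cong (finToVec m) gi≡gj ⟩
      finToVec m (g j)        ≡⟨ finToVec-vecToFin m _ ⟩
      f (finToVec n j)        ∎)) ⟩
    vecToFin n (finToVec n j) ≡⟨ vecToFin-finToVec n j ⟩
    j                       ∎

module LinearAlgebra
  {q : ℕ} {_+_ _*_ : Op₂ (Fin q)} { -_ : Op₁ (Fin q)} {0# 1# : Fin q}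
  (isCommutativeRing : IsCommutativeRing _≡_ _+_ _*_ -_ 0# 1#)
  (*-inverseʳ : ∀ a → a ≢ 0# → ∃ λ b → a * b ≡ 1#)
  (1<q : 1 < q)
  where

  open IsCommutativeRing isCommutativeRing
    using (isRing; +-assoc; +-comm; +-identityˡ; +-identityʳ; -‿inverseˡ; -‿inverseʳ;
           *-assoc; *-comm; *-identityˡ; distribˡ; distribʳ; zeroˡ; zeroʳ)

  ring : Ring 0ℓ 0ℓ
  ring = record { isRing = isRing }

  open RingProperties ring using (-1*x≈-x)
  open ≡-Reasoning

  K : Set
  K = Fin q

  infixl 6 _⊕_
  infixr 7 _·_

  _⊕_ : ∀ {n} → Vec K n → Vec K n → Vec K n
  _⊕_ = zipWith _+_

  _·_ : ∀ {n} → K → Vec K n → Vec K n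
  a · v = map (a *_) v

  𝟎 : ∀ {n} → Vec K n
  𝟎 {n} = replicate n 0#

  ⊖_ : ∀ {n} → Vec K n → Vec K n
  ⊖_ = map -_

  ⊕-abelianGroup : ℕ → AbelianGroup 0ℓ 0ℓ
  ⊕-abelianGroup n = record
    { Carrier = Vec K n
    ; _∙_ = _⊕_
    ; ε = 𝟎
    ; _⁻¹ = ⊖_
    ; isAbelianGroup = record
      { isGroup = record
        { isMonoid = record
          { isSemigroup = record
            { isMagma = record { isEquivalence = isEquivalence ; ∙-cong = cong₂ _⊕_ }
            ; assoc = Vecₚ.zipWith-assoc +-assoc }
          ; identity = Vecₚ.zipWith-identityˡ +-identityˡ , Vecₚ.zipWith-identityʳ +-identityʳ }
        ; inverse = Vecₚ.zipWith-inverseˡ -‿inverseˡ , Vecₚ.zipWith-inverseʳ -‿inverseʳ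
        ; ⁻¹-cong = cong ⊖_ }
      ; comm = Vecₚ.zipWith-comm +-comm } }

  module ⊕ᴳ {n} = AbelianGroup (⊕-abelianGroup n)
  module ⊕ {n} = AbelianGroupProperties (⊕-abelianGroup n)

  ·-distribˡ-⊕ : ∀ {n} a (u v : Vec K n) → a · (u ⊕ v) ≡ a · u ⊕ a · v
  ·-distribˡ-⊕ a [] [] = refl
  ·-distribˡ-⊕ a (x ∷ u) (y ∷ v) = cong₂ _∷_ (distribˡ a x y) (·-distribˡ-⊕ a u v)

  ·-distribʳ-+ : ∀ {n} a b (u : Vec K n) → (a + b) · u ≡ a · u ⊕ b · u
  ·-distribʳ-+ a b [] = refl
  ·-distribʳ-+ a b (x ∷ u) = cong₂ _∷_ (distribʳ x a b) (·-distribʳ-+ a b u)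

  ·-assoc : ∀ {n} a b (u : Vec K n) → a · b · u ≡ (a * b) · u
  ·-assoc a b u = trans (sym (Vecₚ.map-∘ (a *_) (b *_) u)) (Vecₚ.map-cong (λ x → sym (*-assoc a b x)) u)

  ·-identityˡ : ∀ {n} (u : Vec K n) → 1# · u ≡ u
  ·-identityˡ u = trans (Vecₚ.map-cong *-identityˡ u) (Vecₚ.map-id u)

  ·-zeroˡ : ∀ {n} (u : Vec K n) → 0# · u ≡ 𝟎
  ·-zeroˡ u = trans (Vecₚ.map-cong zeroˡ u) (Vecₚ.map-const u 0#)

  ·-zeroʳ : ∀ {n} a → a · 𝟎 {n} ≡ 𝟎
  ·-zeroʳ {n} a = trans (Vecₚ.map-replicate (a *_) 0# n) (cong (replicate n) (zeroʳ a))

  -1·≡⊖ : ∀ {n} (u : Vec K n) → (- 1#) · u ≡ ⊖ u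
  -1·≡⊖ = Vecₚ.map-cong -1*x≈-x

  lc : ∀ {n r} → Vec K n → Vec (Vec K r) n → Vec K r
  lc [] [] = 𝟎
  lc (a ∷ as) (v ∷ vs) = a · v ⊕ lc as vs

  lc-𝟎 : ∀ {n r} (vs : Vec (Vec K r) n) → lc 𝟎 vs ≡ 𝟎
  lc-𝟎 [] = refl
  lc-𝟎 (v ∷ vs) = trans (cong₂ _⊕_ (·-zeroˡ v) (lc-𝟎 vs)) (⊕ᴳ.identityˡ 𝟎)

  lc-⊕ : ∀ {n r} (as bs : Vec K n) (vs : Vec (Vec K r) n) → lc (as ⊕ bs) vs ≡ lc as vs ⊕ lc bs vs
  lc-⊕ [] [] [] = sym (⊕ᴳ.identityˡ 𝟎)
  lc-⊕ (a ∷ as) (b ∷ bs) (v ∷ vs) = begin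
    (a + b) · v ⊕ lc (as ⊕ bs) vs            ≡⟨ cong₂ _⊕_ (·-distribʳ-+ a b v) (lc-⊕ as bs vs) ⟩
    (a · v ⊕ b · v) ⊕ (lc as vs ⊕ lc bs vs)  ≡⟨ comm∧assoc⇒middleFour ⊕ᴳ.comm ⊕ᴳ.assoc _ _ _ _ ⟩
    (a · v ⊕ lc as vs) ⊕ (b · v ⊕ lc bs vs)  ∎

  lc-· : ∀ {n r} a (as : Vec K n) (vs : Vec (Vec K r) n) → lc (a · as) vs ≡ a · lc as vs
  lc-· a [] [] = sym (·-zeroʳ a)
  lc-· a (b ∷ as) (v ∷ vs) = begin
    (a * b) · v ⊕ lc (a · as) vs  ≡⟨ cong₂ _⊕_ (sym (·-assoc a b v)) (lc-· a as vs) ⟩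
    a · b · v ⊕ a · lc as vs      ≡⟨ ·-distribˡ-⊕ a _ _ ⟨
    a · (b · v ⊕ lc as vs)        ∎

  Independent : ∀ {n r} → Vec (Vec K r) n → Set
  Independent vs = ∀ cs → lc cs vs ≡ 𝟎 → cs ≡ 𝟎

  infix 4 _∈Span_ _∈Span?_

  _∈Span_ : ∀ {m r} → Vec K r → Vec (Vec K r) m → Set
  v ∈Span ws = ∃ λ cs → lc cs ws ≡ v

  lc-injective : ∀ {n r} {vs : Vec (Vec K r) n} → Independent vs → Injective _≡_ _≡_ (λ cs → lc cs vs)
  lc-injective {vs = vs} vs-independent {cs} {ds} lc≡lc = ⊕.x∙y⁻¹≈ε⇒x≈y cs ds (vs-independent (cs ⊕ ⊖ ds) (begin
    lc (cs ⊕ ⊖ ds) vs        ≡⟨ lc-⊕ cs (⊖ ds) vs ⟩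
    lc cs vs ⊕ lc (⊖ ds) vs  ≡⟨ cong (_⊕ lc (⊖ ds) vs) lc≡lc ⟩
    lc ds vs ⊕ lc (⊖ ds) vs  ≡⟨ lc-⊕ ds (⊖ ds) vs ⟨
    lc (ds ⊕ ⊖ ds) vs        ≡⟨ cong (λ x → lc x vs) (⊕ᴳ.inverseʳ ds) ⟩
    lc 𝟎 vs                  ≡⟨ lc-𝟎 vs ⟩
    𝟎                        ∎))

  reexpress : ∀ {m n r} {ws : Vec (Vec K r) m} {vs : Vec (Vec K r) n} → V.All (_∈Span ws) vs → Vec K n → Vec K m
  reexpress [] [] = 𝟎
  reexpress ((k , _) ∷ ks) (a ∷ as) = a · k ⊕ reexpress ks as

  lc-reexpress : ∀ {m n r} {ws : Vec (Vec K r) m} {vs : Vec (Vec K r) n} (ks : V.All (_∈Span ws) vs) cs →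
                 lc (reexpress ks cs) ws ≡ lc cs vs
  lc-reexpress {ws = ws} [] [] = lc-𝟎 ws
  lc-reexpress {ws = ws} {v ∷ vs} ((k , k≡v) ∷ ks) (a ∷ as) = begin
    lc (a · k ⊕ reexpress ks as) ws             ≡⟨ lc-⊕ (a · k) _ ws ⟩
    lc (a · k) ws ⊕ lc (reexpress ks as) ws     ≡⟨ cong₂ _⊕_ (lc-· a k ws) (lc-reexpress ks as) ⟩
    a · lc k ws ⊕ lc as vs                      ≡⟨ cong (λ x → a · x ⊕ lc as vs) k≡v ⟩
    a · v ⊕ lc as vs                            ∎

  ∈Span-trans : ∀ {m n r} {ws : Vec (Vec K r) m} {vs : Vec (Vec K r) n} {v} →
                V.All (_∈Span ws) vs → v ∈Span vs → v ∈Span ws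
  ∈Span-trans ks (cs , lc≡v) = reexpress ks cs , trans (lc-reexpress ks cs) lc≡v

  -- Steinitz exchange by counting: reexpress is injective on the q ^ n coefficient vectors of vs.
  independent⇒length-≤ : ∀ {m n r} {ws : Vec (Vec K r) m} {vs : Vec (Vec K r) n} →
                         Independent vs → V.All (_∈Span ws) vs → n ≤ m
  independent⇒length-≤ {ws = ws} vs-independent ks = injective⇒length-≤ 1<q (reexpress ks) λ {cs} {ds} same →
    lc-injective vs-independent
      (trans (sym (lc-reexpress ks cs)) (trans (cong (λ x → lc x ws) same) (lc-reexpress ks ds)))

  ∈Span-∷ : ∀ {m r} {ws : Vec (Vec K r) m} {v} w → v ∈Span ws → v ∈Span (w ∷ ws)
  ∈Span-∷ w (cs , lc≡v) = 0# ∷ cs , trans (cong₂ _⊕_ (·-zeroˡ w) lc≡v) (⊕ᴳ.identityˡ _)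

  ∈Span-head : ∀ {m r} (w : Vec K r) (ws : Vec (Vec K r) m) → w ∈Span (w ∷ ws)
  ∈Span-head w ws = 1# ∷ 𝟎 , trans (cong₂ _⊕_ (·-identityˡ w) (lc-𝟎 ws)) (⊕ᴳ.identityʳ w)

  _∈Span?_ : ∀ {m r} (v : Vec K r) (ws : Vec (Vec K r) m) → Dec (v ∈Span ws)
  v ∈Span? [] = map′ (λ 𝟎≡v → [] , 𝟎≡v) (λ { ([] , 𝟎≡v) → 𝟎≡v }) (Vecₚ.≡-dec Finₚ._≟_ 𝟎 v)
  v ∈Span? (w ∷ ws) = map′ to from (Finₚ.any? λ a → v ⊕ ⊖ (a · w) ∈Span? ws)
    where
    to : ∃ (λ a → v ⊕ ⊖ (a · w) ∈Span ws) → v ∈Span (w ∷ ws)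
    to (a , cs , lc≡) = a ∷ cs , (begin
      a · w ⊕ lc cs ws               ≡⟨ cong (a · w ⊕_) lc≡ ⟩
      a · w ⊕ (v ⊕ ⊖ (a · w))        ≡⟨ ⊕ᴳ.assoc _ _ _ ⟨
      a · w ⊕ v ⊕ ⊖ (a · w)          ≡⟨ ⊕.xyx⁻¹≈y _ v ⟩
      v                              ∎)
    from : v ∈Span (w ∷ ws) → ∃ (λ a → v ⊕ ⊖ (a · w) ∈Span ws)
    from (a ∷ cs , lc≡v) = a , cs , (begin
      lc cs ws                       ≡⟨ ⊕.xyx⁻¹≈y (a · w) _ ⟨
      a · w ⊕ lc cs ws ⊕ ⊖ (a · w)   ≡⟨ cong (_⊕ ⊖ (a · w)) lc≡v ⟩
      v ⊕ ⊖ (a · w)                  ∎)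

  independent-∷ : ∀ {m r} {ws : Vec (Vec K r) m} {v} → ¬ v ∈Span ws → Independent ws → Independent (v ∷ ws)
  independent-∷ {ws = ws} {v} v∉⟨ws⟩ ws-independent (a ∷ cs) lc≡𝟎 with a Finₚ.≟ 0#
  ... | yes refl = cong (0# ∷_) (ws-independent cs (begin
    lc cs ws              ≡⟨ ⊕ᴳ.identityˡ _ ⟨
    𝟎 ⊕ lc cs ws          ≡⟨ cong (_⊕ lc cs ws) (·-zeroˡ v) ⟨
    0# · v ⊕ lc cs ws     ≡⟨ lc≡𝟎 ⟩
    𝟎                     ∎))
  ... | no a≢0 with b , ab≡1 ← *-inverseʳ a a≢0 = ⊥-elim (v∉⟨ws⟩ ((b * (- 1#)) · cs , (begin
    lc ((b * (- 1#)) · cs) ws   ≡⟨ lc-· _ cs ws ⟩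
    (b * (- 1#)) · lc cs ws     ≡⟨ ·-assoc b (- 1#) _ ⟨
    b · (- 1#) · lc cs ws       ≡⟨ cong (b ·_) (-1·≡⊖ _) ⟩
    b · ⊖ lc cs ws              ≡⟨ cong (b ·_) (⊕.inverseˡ-unique (a · v) _ lc≡𝟎) ⟨
    b · a · v                   ≡⟨ ·-assoc b a v ⟩
    (b * a) · v                 ≡⟨ cong (_· v) (trans (*-comm b a) ab≡1) ⟩
    1# · v                      ≡⟨ ·-identityˡ v ⟩
    v                           ∎)))

-- Lists of distinct elements, and minimal elements

unique-⊆⇒length-≤ : ∀ {A : Set} {xs ys : List A} → Unique xs → All (_∈ ys) xs → length xs ≤ length ys
unique-⊆⇒length-≤ [] _ = z≤n
unique-⊆⇒length-≤ {xs = x ∷ xs} (x∉xs ∷ xs-unique) (x∈ys ∷ xs⊆ys) with us , vs , refl ← ∈-∃++ x∈ys =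
  subst (suc (length xs) ≤_) (sym length-split) (s≤s (unique-⊆⇒length-≤ xs-unique (tabulate drop-x)))
  where
  length-split : length (us ++ x ∷ vs) ≡ suc (length (us ++ vs))
  length-split = trans (length-++ us) (trans (ℕ.+-suc _ _) (cong suc (sym (length-++ us))))
  drop-x : ∀ {y} → y ∈ xs → y ∈ us ++ vs
  drop-x y∈xs with ∈-++⁻ us (All-lookup xs⊆ys y∈xs)
  ... | inj₁ y∈us = ∈-++⁺ˡ y∈us
  ... | inj₂ (here refl) = ⊥-elim (All-lookup x∉xs y∈xs refl)
  ... | inj₂ (there y∈vs) = ∈-++⁺ʳ us y∈vs

listsOver : ∀ {A : Set} → List A → ℕ → List (List A)
listsOver S zero = [ [] ]
listsOver S (suc k) = cartesianProductWith _∷_ S (listsOver S k)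

∈-listsOver : ∀ {A : Set} {S xs : List A} → All (_∈ S) xs → xs ∈ listsOver S (length xs)
∈-listsOver [] = here refl
∈-listsOver (x∈S ∷ xs⊆S) = ∈-cartesianProductWith⁺ _∷_ x∈S (∈-listsOver xs⊆S)

shortListsOver : ∀ {A : Set} → List A → List (List A)
shortListsOver S = concatMap (listsOver S) (upTo (suc (length S)))

unique⇒∈-shortListsOver : ∀ {A : Set} {S xs : List A} → Unique xs → All (_∈ S) xs → xs ∈ shortListsOver S
unique⇒∈-shortListsOver xs-unique xs⊆S =
  ∈-concatMap⁺ (listsOver _) (lose (∈-upTo⁺ (s≤s (unique-⊆⇒length-≤ xs-unique xs⊆S))) (∈-listsOver xs⊆S))

module _ {A : Set} (size : A → ℕ) (_≺_ : A → A → Set) (≺-shrinks : ∀ {a b} → b ≺ a → size b < size a) where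
  open RawMonad (¬¬-Monad {0ℓ})

  ¬¬-minimal : (P : A → Set) → ∀ {a} → P a → ¬ ¬ ∃ λ m → P m × (∀ {b} → b ≺ m → ¬ P b)
  ¬¬-minimal P {a} = descend (<-wellFounded (size a))
    where
    descend : ∀ {a} → Acc _<_ (size a) → P a → ¬ ¬ ∃ λ m → P m × (∀ {b} → b ≺ m → ¬ P b)
    descend {a} (acc smaller) Pa = do
      below? ← ¬¬-excluded-middle {A = ∃ λ b → b ≺ a × P b}
      case below? of λ where
        (yes (b , b≺a , Pb)) → descend (smaller (≺-shrinks b≺a)) Pb
        (no nothing-below)   → pure (a , Pa , λ {b} b≺a Pb → nothing-below (b , b≺a , Pb))

-- Matroids represented over ℤ/qℤ, q prime

⊆ₗ-trans : ∀ {X Y Z : List ℕ} → X ⊆ₗ Y → Y ⊆ₗ Z → X ⊆ₗ Z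
⊆ₗ-trans X⊆Y Y⊆Z = All-map (All-lookup Y⊆Z) X⊆Y

module GFMatroids (q : ℕ) .{{_ : NonZero q}} (q-prime : Prime q) where
  open ℤ/qℤ q using (isCommutativeRing; *-inverseʳ)
  open LinearAlgebra isCommutativeRing (*-inverseʳ q-prime) (ℕ.nonTrivial⇒n>1 q {{prime⇒nonTrivial q-prime}})

  module Representation {r} (φ : ℕ → Vec (GF q) r) where

    φ⟨_⟩ : (X : List ℕ) → Vec (Vec K r) (length X)
    φ⟨ X ⟩ = map φ (fromList X)

    coeffs : (ℕ → K) → (X : List ℕ) → Vec K (length X)
    coeffs c X = map c (fromList X)

    lincomb≡lc : ∀ c X → lincomb q c φ X ≡ lc (coeffs c X) φ⟨ X ⟩
    lincomb≡lc c [] = refl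
    lincomb≡lc c (x ∷ X) = cong (c x · φ x ⊕_) (lincomb≡lc c X)

    coeffs≡𝟎⇒All : ∀ c X → coeffs c X ≡ 𝟎 → All (λ x → c x ≡ 0F q) X
    coeffs≡𝟎⇒All c [] _ = []
    coeffs≡𝟎⇒All c (x ∷ X) eq = Vecₚ.∷-injectiveˡ eq ∷ coeffs≡𝟎⇒All c X (Vecₚ.∷-injectiveʳ eq)

    All⇒coeffs≡𝟎 : ∀ c X → All (λ x → c x ≡ 0F q) X → coeffs c X ≡ 𝟎
    All⇒coeffs≡𝟎 c [] [] = refl
    All⇒coeffs≡𝟎 c (x ∷ X) (cx≡0 ∷ rest) = cong₂ _∷_ cx≡0 (All⇒coeffs≡𝟎 c X rest)

    coeffs-cong : ∀ {c c′} X → All (λ x → c x ≡ c′ x) X → coeffs c X ≡ coeffs c′ X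
    coeffs-cong [] [] = refl
    coeffs-cong (x ∷ X) (cx≡c′x ∷ rest) = cong₂ _∷_ cx≡c′x (coeffs-cong X rest)

    coeffs-surjective : ∀ {X} → Unique X → (cs : Vec K (length X)) → ∃ λ c → coeffs c X ≡ cs
    coeffs-surjective [] [] = (λ _ → 0F q) , refl
    coeffs-surjective {x ∷ X} (x∉X ∷ X-unique) (a ∷ cs) with c , refl ← coeffs-surjective X-unique cs =
      c′ , cong₂ _∷_ c′-at-x (coeffs-cong X (All-map c′-off-x x∉X))
      where
      c′ : ℕ → K
      c′ y with y ≟ x
      ... | yes _ = a
      ... | no _ = c y
      c′-at-x : c′ x ≡ a
      c′-at-x with x ≟ x
      ... | yes _ = refl
      ... | no x≢x = ⊥-elim (x≢x refl)
      c′-off-x : ∀ {y} → x ≢ y → c′ y ≡ c y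
      c′-off-x {y} x≢y with y ≟ x
      ... | yes y≡x = ⊥-elim (x≢y (sym y≡x))
      ... | no _ = refl

    LinIndep⇒Independent : ∀ {X} → Unique X → LinIndep q φ X → Independent φ⟨ X ⟩
    LinIndep⇒Independent {X} X-unique X-linIndep cs lc≡𝟎 with c , refl ← coeffs-surjective X-unique cs =
      All⇒coeffs≡𝟎 c X (X-linIndep c (trans (lincomb≡lc c X) lc≡𝟎))

    Independent⇒LinIndep : ∀ {X} → Independent φ⟨ X ⟩ → LinIndep q φ X
    Independent⇒LinIndep {X} X-independent c lincomb≡𝟎 =
      coeffs≡𝟎⇒All c X (X-independent (coeffs c X) (trans (sym (lincomb≡lc c X)) lincomb≡𝟎))

    infix 4 _∈⟨_⟩ _∈⟨_⟩?

    _∈⟨_⟩ : ℕ → List ℕ → Set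
    e ∈⟨ B ⟩ = φ e ∈Span φ⟨ B ⟩

    _∈⟨_⟩? : ∀ e B → Dec (e ∈⟨ B ⟩)
    e ∈⟨ B ⟩? = φ e ∈Span? φ⟨ B ⟩

    ∈⇒∈⟨⟩ : ∀ {e B} → e ∈ B → e ∈⟨ B ⟩
    ∈⇒∈⟨⟩ {B = b ∷ B} (here refl) = ∈Span-head (φ b) φ⟨ B ⟩
    ∈⇒∈⟨⟩ {B = b ∷ B} (there e∈B) = ∈Span-∷ (φ b) (∈⇒∈⟨⟩ e∈B)

    All-∈⟨⟩ : ∀ {B S} → All (_∈⟨ B ⟩) S → V.All (_∈Span φ⟨ B ⟩) φ⟨ S ⟩
    All-∈⟨⟩ [] = []
    All-∈⟨⟩ (e∈⟨B⟩ ∷ S⊆⟨B⟩) = e∈⟨B⟩ ∷ All-∈⟨⟩ S⊆⟨B⟩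

    ∈⟨⟩-trans : ∀ {B S e} → All (_∈⟨ B ⟩) S → e ∈⟨ S ⟩ → e ∈⟨ B ⟩
    ∈⟨⟩-trans S⊆⟨B⟩ = ∈Span-trans (All-∈⟨⟩ S⊆⟨B⟩)

    ∈⟨⟩-mono : ∀ {B S e} → S ⊆ₗ B → e ∈⟨ S ⟩ → e ∈⟨ B ⟩
    ∈⟨⟩-mono S⊆B = ∈⟨⟩-trans (All-map ∈⇒∈⟨⟩ S⊆B)

    record Basis (S : List ℕ) : Set where
      field
        B           : List ℕ
        B⊆          : B ⊆ₗ S
        unique      : Unique B
        independent : Independent φ⟨ B ⟩
        spans       : All (_∈⟨ B ⟩) S

    basis-∷ : ∀ s {S} → Basis S → Basis (s ∷ S)
    basis-∷ s b with s ∈⟨ Basis.B b ⟩?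
    ... | yes s∈⟨B⟩ = record
      { B = B ; B⊆ = All-map there B⊆ ; unique = unique ; independent = independent ; spans = s∈⟨B⟩ ∷ spans }
      where open Basis b
    ... | no s∉⟨B⟩ = record
      { B = s ∷ B
      ; B⊆ = here refl ∷ All-map there B⊆
      ; unique = ¬Any⇒All¬ B (s∉⟨B⟩ ∘ ∈⇒∈⟨⟩) ∷ unique
      ; independent = independent-∷ s∉⟨B⟩ independent
      ; spans = ∈⇒∈⟨⟩ (here refl) ∷ All-map (∈Span-∷ (φ s)) spans }
      where open Basis b

    basis : ∀ S → Basis S
    basis [] = record { B = [] ; B⊆ = [] ; unique = [] ; independent = λ { [] _ → refl } ; spans = [] }
    basis (s ∷ S) = basis-∷ s (basis S)

    Represents : Matroid → Set
    Represents M = ∀ X → X ⊆ₗ E M → Unique X → (Indep M X ⇔ LinIndep q φ X)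

    Represents-∣ : ∀ {M F} → Represents M → F ⊆ₗ E M → Represents (M ∣ F)
    Represents-∣ rep F⊆E X X⊆F = rep X (⊆ₗ-trans X⊆F F⊆E)

    module _ {M : Matroid} (rep : Represents M) where

      IndepSet⇒Independent : ∀ {X} → IndepSet M X → Independent φ⟨ X ⟩
      IndepSet⇒Independent (X⊆E , X-unique , X-indep) =
        LinIndep⇒Independent X-unique (Equivalence.to (rep _ X⊆E X-unique) X-indep)

      independent⇒IndepSet : ∀ {X} → X ⊆ₗ E M → Unique X → Independent φ⟨ X ⟩ → IndepSet M X
      independent⇒IndepSet X⊆E X-unique X-independent =
        X⊆E , X-unique , Equivalence.from (rep _ X⊆E X-unique) (Independent⇒LinIndep X-independent)

      IndepSet⇒length-≤ : ∀ {X S} → IndepSet M X → All (_∈⟨ S ⟩) X → length X ≤ length S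
      IndepSet⇒length-≤ X-indep X⊆⟨S⟩ = independent⇒length-≤ (IndepSet⇒Independent X-indep) (All-∈⟨⟩ X⊆⟨S⟩)

      Closed : List ℕ → Set
      Closed F = ∀ e → e ∈ E M → e ∉ F → ¬ e ∈⟨ F ⟩

      closed⇒Flat : ∀ {F} → F ⊆ₗ E M → Unique F → Closed F → Flat M F
      closed⇒Flat {F} F⊆E F-unique F-closed = F⊆E , F-unique , λ e e∈E e∉F →
        let e∉⟨B⟩ = F-closed e e∈E e∉F ∘ ∈⟨⟩-mono B⊆ in
        e ∷ B ,
        independent⇒IndepSet (e∈E ∷ ⊆ₗ-trans B⊆ F⊆E) (¬Any⇒All¬ B (e∉⟨B⟩ ∘ ∈⇒∈⟨⟩) ∷ unique)
                             (independent-∷ e∉⟨B⟩ independent) ,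
        here refl ∷ All-map there B⊆ ,
        λ J J-indep J⊆F → s≤s (IndepSet⇒length-≤ J-indep (All-map (All-lookup spans) J⊆F))
        where open Basis (basis F)

      Flat⇒closed : ∀ {F} → Flat M F → Closed F
      Flat⇒closed {F} (F⊆E , _ , F-flat) e e∈E e∉F e∈⟨F⟩ with I , I-indep , I⊆eF , I-larger ← F-flat e e∈E e∉F =
        ℕ.≤⇒≯ (IndepSet⇒length-≤ I-indep (All-map ∈⟨B⟩ I⊆eF))
              (I-larger B (independent⇒IndepSet (⊆ₗ-trans B⊆ F⊆E) unique independent) B⊆)
        where
        open Basis (basis F)
        ∈⟨B⟩ : ∀ {x} → x ∈ e ∷ F → x ∈⟨ B ⟩
        ∈⟨B⟩ (here refl) = ∈⟨⟩-trans spans e∈⟨F⟩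
        ∈⟨B⟩ (there x∈F) = All-lookup spans x∈F

    IndepSet-∣-basis : ∀ {M F} → Represents M → F ⊆ₗ E M → (b : Basis F) → IndepSet (M ∣ F) (Basis.B b)
    IndepSet-∣-basis rep F⊆E b = independent⇒IndepSet (Represents-∣ rep F⊆E) B⊆ unique independent
      where open Basis b

    Flat-trans : ∀ {M F F′} → Represents M → Flat M F → Flat (M ∣ F) F′ → Flat M F′
    Flat-trans {F = F} rep F-flat@(F⊆E , _) F′-flat@(F′⊆F , F′-unique , _) =
      closed⇒Flat rep (⊆ₗ-trans F′⊆F F⊆E) F′-unique F′-closed
      where
      F′-closed : Closed rep _
      F′-closed e e∈E e∉F′ with e ∈? F
      ... | yes e∈F = Flat⇒closed (Represents-∣ rep F⊆E) F′-flat e e∈F e∉F′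
      ... | no e∉F = Flat⇒closed rep F-flat e e∈E e∉F ∘ ∈⟨⟩-mono F′⊆F

    Flat⇒Flat-∣ : ∀ {M F G} → Represents M → Flat M F → F ⊆ₗ G → G ⊆ₗ E M → Flat (M ∣ G) F
    Flat⇒Flat-∣ rep F-flat@(_ , F-unique , _) F⊆G G⊆E =
      closed⇒Flat (Represents-∣ rep G⊆E) F⊆G F-unique λ e e∈G → Flat⇒closed rep F-flat e (All-lookup G⊆E e∈G)

    closure : Matroid → List ℕ → List ℕ
    closure M W = filter (_∈⟨ W ⟩?) (E M)

    closure⊆E : ∀ M W → closure M W ⊆ₗ E M
    closure⊆E M W = tabulate (proj₁ ∘ ∈-filter⁻ (_∈⟨ W ⟩?) {xs = E M})

    closure⊆⟨⟩ : ∀ M W → All (_∈⟨ W ⟩) (closure M W)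
    closure⊆⟨⟩ M W = tabulate (proj₂ ∘ ∈-filter⁻ (_∈⟨ W ⟩?) {xs = E M})

    ⊆closure : ∀ M {W F} → F ⊆ₗ E M → All (_∈⟨ W ⟩) F → F ⊆ₗ closure M W
    ⊆closure M F⊆E F⊆⟨W⟩ = tabulate λ x∈F → ∈-filter⁺ (_∈⟨ _ ⟩?) (All-lookup F⊆E x∈F) (All-lookup F⊆⟨W⟩ x∈F)

    closure-Flat : ∀ {M} W → Represents M → Unique (E M) → Flat M (closure M W)
    closure-Flat {M} W rep E-unique =
      closed⇒Flat rep (closure⊆E M W) (filter⁺ (_∈⟨ W ⟩?) E-unique) λ e e∈E e∉cl e∈⟨cl⟩ →
        e∉cl (∈-filter⁺ (_∈⟨ W ⟩?) e∈E (∈⟨⟩-trans (closure⊆⟨⟩ M W) e∈⟨cl⟩))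

    bases-span-++ : ∀ {F₁ F₂} (b₁ : Basis F₁) (b₂ : Basis F₂) → All (_∈⟨ Basis.B b₁ ++ Basis.B b₂ ⟩) (F₁ ++ F₂)
    bases-span-++ b₁ b₂ =
      ++⁺ (All-map (∈⟨⟩-mono (tabulate ∈-++⁺ˡ)) (Basis.spans b₁))
          (All-map (∈⟨⟩-mono (tabulate (∈-++⁺ʳ (Basis.B b₁)))) (Basis.spans b₂))

    module _ {𝓜₁ 𝓜₂ : Class q} (h₁ : Hereditary q 𝓜₁) (h₂ : Hereditary q 𝓜₂)
             {N} (rep : Represents N) (E-unique : Unique (E N))
             (proper-flats : ∀ F → Flat N F → Proper N F → (𝓜₁ ∪ᶜ 𝓜₂) (N ∣ F)) where

      nonmember-flats-span : ∀ {F₁ F₂} → Flat N F₁ → ¬ 𝓜₁ (N ∣ F₁) → Flat N F₂ → ¬ 𝓜₂ (N ∣ F₂) →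
                             All (_∈⟨ F₁ ++ F₂ ⟩) (E N)
      nonmember-flats-span {F₁} {F₂} F₁-flat F₁∉𝓜₁ F₂-flat F₂∉𝓜₂ with all? (_∈⟨ F₁ ++ F₂ ⟩?) (E N)
      ... | yes E⊆⟨F₁F₂⟩ = E⊆⟨F₁F₂⟩
      ... | no E⊈⟨F₁F₂⟩ with e , e∈E , e∉⟨F₁F₂⟩ ← find (¬All⇒Any¬ (_∈⟨ F₁ ++ F₂ ⟩?) (E N) E⊈⟨F₁F₂⟩) =
        ⊥-elim ([ G∉𝓜₁ , G∉𝓜₂ ]′ (proper-flats G (closure-Flat _ rep E-unique) G-proper))
        where
        G : List ℕ
        G = closure N (F₁ ++ F₂)
        G-proper : Proper N G
        G-proper = e , e∈E , e∉⟨F₁F₂⟩ ∘ All-lookup (closure⊆⟨⟩ N _)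
        G∉𝓜₁ : ¬ 𝓜₁ (N ∣ G)
        G∉𝓜₁ G∈𝓜₁ = F₁∉𝓜₁ (h₁ (N ∣ G) F₁ G∈𝓜₁ (Flat⇒Flat-∣ rep F₁-flat
          (⊆closure N (proj₁ F₁-flat) (tabulate λ x∈F₁ → ∈⇒∈⟨⟩ (∈-++⁺ˡ x∈F₁))) (closure⊆E N _)))
        G∉𝓜₂ : ¬ 𝓜₂ (N ∣ G)
        G∉𝓜₂ G∈𝓜₂ = F₂∉𝓜₂ (h₂ (N ∣ G) F₂ G∈𝓜₂ (Flat⇒Flat-∣ rep F₂-flat
          (⊆closure N (proj₁ F₂-flat) (tabulate λ x∈F₂ → ∈⇒∈⟨⟩ (∈-++⁺ʳ F₁ x∈F₂))) (closure⊆E N _)))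

  GFMatroid-∣ : ∀ {M F} → GFMatroid q M → F ⊆ₗ E M → Unique F → GFMatroid q (M ∣ F)
  GFMatroid-∣ (_ , (loopless , no-parallels) , r , φ , rep) F⊆E F-unique =
    F-unique ,
    ((λ e e∈F → loopless e (All-lookup F⊆E e∈F)) ,
     (λ e f e∈F f∈F → no-parallels e f (All-lookup F⊆E e∈F) (All-lookup F⊆E f∈F))) ,
    r , φ , Representation.Represents-∣ φ rep F⊆E

  open RawMonad (¬¬-Monad {0ℓ})

  ¬¬-forbiddenFlat : ∀ 𝓜 {N} → GFMatroid q N → ¬ 𝓜 N → ¬ ¬ ∃ λ F → Flat N F × ForbiddenFlat q 𝓜 (N ∣ F)
  ¬¬-forbiddenFlat 𝓜 {N} N-GF@(E-unique , _ , _ , φ , rep) N∉𝓜 = do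
    -- N ∣ E N and (N ∣ F) ∣ F′ are N and N ∣ F′ by record η.
    F , (F-flat , F∉𝓜) , minimal ←
      ¬¬-minimal length _≺_ ≺-shrinks (λ F → Flat N F × ¬ 𝓜 (N ∣ F)) (E-flat , N∉𝓜)
    -- The subflats of F are among the finitely many shortListsOver F, so 𝓜 can be decided on all of them.
    decisions ← sequenceM 0ℓ (¬¬-Monad {0ℓ}) (tabulate {xs = shortListsOver F} λ _ → ¬¬-excluded-middle)
    pure (F , F-flat , GFMatroid-∣ N-GF (proj₁ F-flat) (proj₁ (proj₂ F-flat)) , F∉𝓜 ,
          λ F′ F′-flat@(F′⊆F , F′-unique , _) F′-proper →
            decidable-stable (All-lookup decisions (unique⇒∈-shortListsOver F′-unique F′⊆F))
              λ F′∉𝓜 → minimal (F′-flat , F′-proper) (Flat-trans rep F-flat F′-flat , F′∉𝓜))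
    where
    open Representation φ
    _≺_ : List ℕ → List ℕ → Set
    F′ ≺ F = Flat (N ∣ F) F′ × Proper (N ∣ F) F′
    ≺-shrinks : ∀ {F F′} → F′ ≺ F → length F′ < length F
    ≺-shrinks ((F′⊆F , F′-unique , _) , e , e∈F , e∉F′) =
      unique-⊆⇒length-≤ (¬Any⇒All¬ _ e∉F′ ∷ F′-unique) (e∈F ∷ F′⊆F)
    E-flat : Flat N (E N)
    E-flat = closed⇒Flat rep (tabulate λ e∈E → e∈E) E-unique λ e e∈E e∉E → ⊥-elim (e∉E e∈E)

  forbiddenFlat-∪ᶜ-rank-≤ : ∀ {𝓜₁ 𝓜₂ : Class q} → Hereditary q 𝓜₁ → Hereditary q 𝓜₂ → ∀ c d →
    (∀ N → ForbiddenFlat q 𝓜₁ N → RankLE N c) →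
    (∀ N → ForbiddenFlat q 𝓜₂ N → RankLE N d) →
    ∀ N → ForbiddenFlat q (𝓜₁ ∪ᶜ 𝓜₂) N → RankLE N (c ℕ.+ d)
  forbiddenFlat-∪ᶜ-rank-≤ {𝓜₁} {𝓜₂} h₁ h₂ c d c-bound d-bound N
                          (N-GF@(E-unique , _ , _ , φ , rep) , N∉𝓜 , proper-flats) X X-indep@(X⊆E , _) =
    decidable-stable (length X ≤? c ℕ.+ d) do
      F₁ , F₁-flat@(F₁⊆E , _) , F₁-forbidden@(_ , F₁∉𝓜₁ , _) ← ¬¬-forbiddenFlat 𝓜₁ N-GF (N∉𝓜 ∘ inj₁)
      F₂ , F₂-flat@(F₂⊆E , _) , F₂-forbidden@(_ , F₂∉𝓜₂ , _) ← ¬¬-forbiddenFlat 𝓜₂ N-GF (N∉𝓜 ∘ inj₂)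
      let B₁ = Basis.B (basis F₁)
          B₂ = Basis.B (basis F₂)
          E⊆⟨F₁F₂⟩ = nonmember-flats-span h₁ h₂ rep E-unique proper-flats F₁-flat F₁∉𝓜₁ F₂-flat F₂∉𝓜₂
          X⊆⟨B₁B₂⟩ = All-map (∈⟨⟩-trans (bases-span-++ (basis F₁) (basis F₂)) ∘ All-lookup E⊆⟨F₁F₂⟩) X⊆E
          B₁≤c = c-bound (N ∣ F₁) F₁-forbidden B₁ (IndepSet-∣-basis rep F₁⊆E (basis F₁))
          B₂≤d = d-bound (N ∣ F₂) F₂-forbidden B₂ (IndepSet-∣-basis rep F₂⊆E (basis F₂))
      pure (begin
        length X                      ≤⟨ IndepSet⇒length-≤ rep X-indep X⊆⟨B₁B₂⟩ ⟩
        length (B₁ ++ B₂)             ≡⟨ length-++ B₁ ⟩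
        length B₁ ℕ.+ length B₂       ≤⟨ ℕ.+-mono-≤ B₁≤c B₂≤d ⟩
        c ℕ.+ d                       ∎)
    where
    open Representation φ
    open ℕ.≤-Reasoning

∪ᶜ-hereditary : ∀ {q} .{{_ : NonZero q}} {𝓜₁ 𝓜₂ : Class q} →
                Hereditary q 𝓜₁ → Hereditary q 𝓜₂ → Hereditary q (𝓜₁ ∪ᶜ 𝓜₂)
∪ᶜ-hereditary h₁ h₂ M F (inj₁ M∈𝓜₁) F-flat = inj₁ (h₁ M F M∈𝓜₁ F-flat)
∪ᶜ-hereditary h₁ h₂ M F (inj₂ M∈𝓜₂) F-flat = inj₂ (h₂ M F M∈𝓜₂ F-flat)

open import Data.Nat using (_+_)

proposition5p3 : (q : ℕ) .{{_ : NonZero q}} → (q ≡ 2 ⊎ q ≡ 3) →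
    (𝓜₁ 𝓜₂ : Matroid → Set) →
    ClassOfGF q 𝓜₁ → ClassOfGF q 𝓜₂ →
    Hereditary q 𝓜₁ → Hereditary q 𝓜₂ →
    Hereditary q (𝓜₁ ∪ᶜ 𝓜₂) ×
    (∀ (c d : ℕ) →
    (∀ N → ForbiddenFlat q 𝓜₁ N → RankLE N c) →
    (∀ N → ForbiddenFlat q 𝓜₂ N → RankLE N d) →
    ∀ N → ForbiddenFlat q (𝓜₁ ∪ᶜ 𝓜₂) N → RankLE N (c + d))
proposition5p3 q q≡2⊎q≡3 𝓜₁ 𝓜₂ _ _ h₁ h₂ =
  ∪ᶜ-hereditary h₁ h₂ , GFMatroids.forbiddenFlat-∪ᶜ-rank-≤ q (q-prime q≡2⊎q≡3) h₁ h₂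
  where
  q-prime : q ≡ 2 ⊎ q ≡ 3 → Prime q
  q-prime (inj₁ refl) = prime[2]
  q-prime (inj₂ refl) = from-yes (prime? 3)
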